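{- Let $G$ be an abelian group (written additively), let $A \subseteq G$ be a finite set, and set $H = \mathrm{stab}(\Sigma(A))$. Then $$|\Sigma(A)| \ge |H| + |H|\cdot|A \setminus H|.$$
   Context: For a finite set $A\subseteq G$, $\Sigma(A) = \{\sum_{a\in A'} a : A' \subseteq A\}$ is the set of all subset sums of $A$ (the empty sum being $0$). For $X \subseteq G$, $\mathrm{stab}(X) = \{g \in G : g + X = X\}$, a subgroup of $G$. -}

module Defs where

open import Level using (Level; _⊔_)
open import Algebra.Bundles using (AbelianGroup)
open import Data.List using (List; []; _∷_; length; foldr)
open import Data.List.Relation.Binary.Sublist.Propositional using (_⊆_)
import Data.List.Membership.Setoid as SetoidMembership
import Data.List.Relation.Unary.Unique.Setoid as SetoidUnique
open import Data.Nat using (ℕ)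
open import Data.Product using (Σ; ∃; _×_)
open import Relation.Nullary using (¬_)
open import Relation.Binary.PropositionalEquality using (_≡_)
open import Function.Bundles using (_⇔_)

module _ {c ℓ : Level} (G : AbelianGroup c ℓ) where
  open AbelianGroup G

  SubsetOf : Set _
  SubsetOf = Carrier → Set (c ⊔ ℓ)

  sumG : List Carrier → Carrier
  sumG = foldr _∙_ ε

  _∈L_ : Carrier → List Carrier → Set (c ⊔ ℓ)
  x ∈L xs = SetoidMembership._∈_ setoid x xs

  -- a finite set A ⊆ G is given by a duplicate-free list (up to ≈)
  IsFiniteSet : List Carrier → Set (c ⊔ ℓ)
  IsFiniteSet = SetoidUnique.Unique setoid

  SubsetSums : List Carrier → SubsetOf
  SubsetSums A x = Σ (List Carrier) λ A' → A' ⊆ A × (sumG A' ≈ x)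

  -- stab(X) = { g : g + X = X }, i.e.  y ∈ X  ⇔  ∃ x ∈ X, y ≈ g + x
  Stab : SubsetOf → SubsetOf
  Stab X g = ∀ y → X y ⇔ (Σ Carrier λ x → X x × (y ≈ g ∙ x))

  Diff : List Carrier → SubsetOf → SubsetOf
  Diff A H y = (y ∈L A) × ¬ H y

  HasSize : SubsetOf → ℕ → Set (c ⊔ ℓ)
  HasSize X n = Σ (List Carrier) λ L →
    SetoidUnique.Unique setoid L × (length L ≡ n) × (∀ y → X y ⇔ (y ∈L L))

{-# OPTIONS --safe #-}
module Submission where

-- Let H = stab(Σ(A)), so that Σ(A) = H + Σ(A), and build this set by adding the elements
-- of A one at a time to H + Σ([]) = H. Every H + Σ(T) is a union of H-cosets, and its
-- stabiliser only grows as T grows, so stab(H + Σ(T)) ⊆ H. An element a ∉ H therefore does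
-- not stabilise the finite set H + Σ(T); since a translation mapping a finite set into itself
-- has torsion and hence stabilises it, some y ∈ H + Σ(T) has a + y ∉ H + Σ(T), and the whole
-- coset H + a + y is new in H + Σ(a ∷ T). So each element of A ∖ H contributes |H| new sums.
-- Membership in a setoid is undecidable, so the argument runs in the double-negation monad;
-- this is harmless because the conclusion is a decidable inequality.

open import Defs
open import Level using (Level; _⊔_)
open import Algebra.Bundles using (AbelianGroup)
open import Data.Empty using (⊥-elim)
open import Data.Fin using (Fin; toℕ; zero; suc)
open import Data.Fin.Properties using (injective⇒≤; pigeonhole)
open import Data.List using (List; []; _∷_; length; lookup; map; _++_)
open import Data.List.Properties using (length-++; length-map)
open import Data.List.Relation.Binary.Sublist.Propositional using ([]; _∷_; _∷ʳ_) renaming (_⊆_ to _⊑_)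
open import Data.List.Relation.Unary.All as All using (All)
open import Data.List.Relation.Unary.AllPairs using (_∷_)
open import Data.List.Relation.Unary.Any as Any using (here; there)
open import Data.List.Relation.Unary.Any.Properties using (lookup-index; ++⁻)
import Data.List.Membership.Setoid as SetoidMembership
import Data.List.Membership.Setoid.Properties as SetoidMembershipProperties
open import Data.List.Membership.Propositional.Properties using (∈-lookup)
import Data.List.Relation.Binary.Subset.Setoid as SetoidSubset
import Data.List.Relation.Unary.Unique.Setoid as SetoidUnique
import Data.List.Relation.Unary.Unique.Setoid.Properties as SetoidUniqueProperties
open import Data.Nat using (ℕ; zero; suc; _+_; _*_; _≤_; _<_; s≤s; _≤?_)
open import Data.Nat.Properties
  using (+-identityʳ; *-zeroʳ; *-suc; +-comm; +-monoʳ-≤; *-monoʳ-≤; n<1+n; module ≤-Reasoning)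
open import Data.Product using (Σ; ∃; _×_; _,_)
open import Data.Sum using (inj₁; inj₂)
open import Effect.Monad using (RawMonad)
open import Function.Bundles using (_⇔_; mk⇔; Equivalence)
open import Relation.Binary.Bundles using (Setoid)
open import Relation.Binary.Definitions using (_Respects_)
open import Relation.Binary.PropositionalEquality as ≡ using (_≡_)
open import Relation.Nullary using (¬_; yes; no)
open import Relation.Nullary.Decidable using (decidable-stable; ¬¬-excluded-middle)
open import Relation.Nullary.Negation using (DoubleNegation; ¬¬-Monad; ¬¬-map)
open import Relation.Unary using (Pred; _⊆_; _∪_)

open Equivalence using (to; from)

module _ {c ℓ} (S : Setoid c ℓ) where
  open Setoid S
  open SetoidMembership S using (_∈_)
  open SetoidSubset S renaming (_⊆_ to _⊆ₗ_)
  open SetoidUnique S using (Unique)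

  lookup-injective : ∀ {xs} → Unique xs → ∀ i j → lookup xs i ≈ lookup xs j → i ≡ j
  lookup-injective (_    ∷ _) zero    zero    _ = ≡.refl
  lookup-injective (x≉xs ∷ _) zero    (suc j) e = ⊥-elim (All.lookup x≉xs (∈-lookup j) e)
  lookup-injective (x≉xs ∷ _) (suc i) zero    e = ⊥-elim (All.lookup x≉xs (∈-lookup i) (sym e))
  lookup-injective (_    ∷ u) (suc i) (suc j) e = ≡.cong suc (lookup-injective u i j e)

  unique-⊆⇒length≤ : ∀ {xs ys} → Unique xs → xs ⊆ₗ ys → length xs ≤ length ys
  unique-⊆⇒length≤ {xs} {ys} u xs⊆ys = injective⇒≤ position-injective
    where
    position : Fin (length xs) → Fin (length ys)
    position i = Any.index (xs⊆ys (SetoidMembershipProperties.∈-lookup S xs i))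
    position-injective : ∀ {i j} → position i ≡ position j → i ≡ j
    position-injective {i} {j} e = lookup-injective u i j
      (trans (lookup-index (xs⊆ys _))
        (trans (reflexive (≡.cong (lookup ys) e)) (sym (lookup-index (xs⊆ys _)))))

module _ {c ℓ} (G : AbelianGroup c ℓ) where
  open AbelianGroup G
  open import Algebra.Properties.AbelianGroup G using (∙-cancelˡ; ∙-cancelʳ; \\-leftDividesʳ)
  open import Algebra.Properties.CommutativeSemigroup commutativeSemigroup using (x∙yz≈y∙xz)
  open import Algebra.Definitions.RawMonoid rawMonoid using () renaming (_×_ to _·_)
  open SetoidMembership setoid using (_∈_)
  open SetoidUnique setoid using (Unique)
  open RawMonad (¬¬-Monad {c ⊔ ℓ})

  ·-period : ∀ {i j} a → i < j → i · a ≈ j · a → ∃ λ d → suc d · a ≈ ε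
  ·-period {zero}  {suc d} a _         e = d , sym e
  ·-period {suc i} {suc j} a (s≤s i<j) e = ·-period a i<j (∙-cancelˡ a _ _ e)

  -- Defined so that Stab G X g y is definitionally X y ⇔ (g ∙ₛ X) y.
  _∙ₛ_ : Carrier → SubsetOf G → SubsetOf G
  (a ∙ₛ X) z = Σ Carrier λ x → X x × z ≈ a ∙ x

  ∙ₛ-resp : ∀ a (X : SubsetOf G) → (a ∙ₛ X) Respects _≈_
  ∙ₛ-resp a X z≈z′ (x , x∈X , z≈ax) = x , x∈X , trans (sym z≈z′) z≈ax

  Stab⇒closed : ∀ {X g x} → Stab G X g → X x → X (g ∙ x)
  Stab⇒closed {g = g} {x} g∈stab x∈X = from (g∈stab (g ∙ x)) (x , x∈X , refl)

  Stab-resp : ∀ {X} → Stab G X Respects _≈_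
  Stab-resp g≈g′ g∈stab y = mk⇔
    (λ y∈X → let (x , x∈X , y≈gx) = to (g∈stab y) y∈X in x , x∈X , trans y≈gx (∙-congʳ g≈g′))
    (λ (x , x∈X , y≈g′x) → from (g∈stab y) (x , x∈X , trans y≈g′x (∙-congʳ (sym g≈g′))))

  Stab-cong : ∀ {X X′} → (∀ z → X z ⇔ X′ z) → Stab G X ⊆ Stab G X′
  Stab-cong X⇔X′ g∈stab y = mk⇔
    (λ y∈X′ → let (x , x∈X , y≈gx) = to (g∈stab y) (from (X⇔X′ y) y∈X′)
              in x , to (X⇔X′ x) x∈X , y≈gx)
    (λ (x , x∈X′ , y≈gx) → to (X⇔X′ y) (from (g∈stab y) (x , from (X⇔X′ x) x∈X′ , y≈gx)))

  Stab-⊆-extend : ∀ {X} a → Stab G X ⊆ Stab G (X ∪ (a ∙ₛ X))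
  Stab-⊆-extend {X} a {g} g∈stab z = mk⇔ forward backward
    where
    forward : (X ∪ (a ∙ₛ X)) z → (g ∙ₛ (X ∪ (a ∙ₛ X))) z
    forward (inj₁ z∈X) = let (x , x∈X , z≈gx) = to (g∈stab z) z∈X in x , inj₁ x∈X , z≈gx
    forward (inj₂ (y , y∈X , z≈ay)) =
      let (x , x∈X , y≈gx) = to (g∈stab y) y∈X
      in a ∙ x , inj₂ (x , x∈X , refl) , trans z≈ay (trans (∙-congˡ y≈gx) (x∙yz≈y∙xz a g x))
    backward : (g ∙ₛ (X ∪ (a ∙ₛ X))) z → (X ∪ (a ∙ₛ X)) z
    backward (x , inj₁ x∈X , z≈gx) = inj₁ (from (g∈stab z) (x , x∈X , z≈gx))
    backward (x , inj₂ (y , y∈X , x≈ay) , z≈gx) =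
      inj₂ (g ∙ y , Stab⇒closed g∈stab y∈X , trans z≈gx (trans (∙-congˡ x≈ay) (x∙yz≈y∙xz g a y)))

  record IsSubgroup (H : SubsetOf G) : Set (c ⊔ ℓ) where
    field
      resp      : H Respects _≈_
      ε-closed  : H ε
      ∙-closed  : ∀ {g h} → H g → H h → H (g ∙ h)
      ⁻¹-closed : ∀ {g} → H g → H (g ⁻¹)

  module _ {X : SubsetOf G} (X-resp : X Respects _≈_) where

    Stab-isSubgroup : IsSubgroup (Stab G X)
    Stab-isSubgroup = record
      { resp      = Stab-resp
      ; ε-closed  = λ y → mk⇔
          (λ y∈X → y , y∈X , sym (identityˡ y))
          (λ (x , x∈X , y≈εx) → X-resp (sym (trans y≈εx (identityˡ x))) x∈X)
      ; ∙-closed  = λ {g} {h} g∈stab h∈stab y → mk⇔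
          (λ y∈X → let (x₁ , x₁∈X , y≈gx₁) = to (g∈stab y) y∈X
                       (x₂ , x₂∈X , x₁≈hx₂) = to (h∈stab x₁) x₁∈X
                   in x₂ , x₂∈X , trans y≈gx₁ (trans (∙-congˡ x₁≈hx₂) (sym (assoc g h x₂))))
          (λ (x , x∈X , y≈ghx) →
             X-resp (sym (trans y≈ghx (assoc g h x))) (Stab⇒closed g∈stab (Stab⇒closed h∈stab x∈X)))
      ; ⁻¹-closed = λ {g} g∈stab y → mk⇔
          (λ y∈X → g ∙ y , Stab⇒closed g∈stab y∈X , sym (\\-leftDividesʳ g y))
          (λ (x , x∈X , y≈g⁻¹x) →
             let (x′ , x′∈X , x≈gx′) = to (g∈stab x) x∈X
             in X-resp (sym (trans y≈g⁻¹x (trans (∙-congˡ x≈gx′) (\\-leftDividesʳ g x′)))) x′∈X)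
      }

    ·-closed : ∀ {a} → (∀ {x} → X x → X (a ∙ x)) → ∀ m {x} → X x → X (m · a ∙ x)
    ·-closed     closed zero    {x} x∈X = X-resp (sym (identityˡ x)) x∈X
    ·-closed {a} closed (suc m) {x} x∈X =
      X-resp (sym (assoc a (m · a) x)) (closed (·-closed closed m x∈X))

    finite-closed⇒torsion : ∀ {a x₀ L} → X x₀ → X ⊆ (_∈ L) →
                            (∀ {x} → X x → X (a ∙ x)) → ∃ λ d → suc d · a ≈ ε
    finite-closed⇒torsion {a} {x₀} {L} x₀∈X X⊆L closed =
      let (i , j , i<j , same-position) = pigeonhole (n<1+n (length L)) position
      in ·-period a i<j (∙-cancelʳ x₀ _ _ (same-position⇒same-point {i} {j} same-position))
      where
      orbit : ∀ m → X (m · a ∙ x₀)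
      orbit m = ·-closed closed m x₀∈X
      position : Fin (suc (length L)) → Fin (length L)
      position j = Any.index (X⊆L (orbit (toℕ j)))
      same-position⇒same-point : ∀ {i j} → position i ≡ position j →
                                 toℕ i · a ∙ x₀ ≈ toℕ j · a ∙ x₀
      same-position⇒same-point e =
        trans (lookup-index (X⊆L _))
          (trans (reflexive (≡.cong (lookup L) e)) (sym (lookup-index (X⊆L _))))

    torsion-closed⇒Stab : ∀ {a d} → suc d · a ≈ ε → (∀ {x} → X x → X (a ∙ x)) → Stab G X a
    torsion-closed⇒Stab {a} {d} a-torsion closed y = mk⇔
      (λ y∈X → d · a ∙ y , ·-closed closed d y∈X , y≈a∙[d·a∙y])
      (λ (x , x∈X , y≈ax) → X-resp (sym y≈ax) (closed x∈X))
      where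
      y≈a∙[d·a∙y] : y ≈ a ∙ (d · a ∙ y)
      y≈a∙[d·a∙y] = trans (sym (identityˡ y)) (trans (∙-congʳ (sym a-torsion)) (assoc a (d · a) y))

    ¬Stab⇒¬¬escape : ∀ {a x₀ L} → X x₀ → X ⊆ (_∈ L) → ¬ Stab G X a →
                     DoubleNegation (∃ λ y → X y × ¬ X (a ∙ y))
    -- Double negation commutes with the finite conjunction over L, not with one over all of G.
    ¬Stab⇒¬¬escape {a} {x₀} {L} x₀∈X X⊆L a∉stab no-escape =
      ¬¬-map closed⇒Stab (All.sequenceM ℓ ¬¬-Monad (All.universal ¬¬closed-at L)) a∉stab
      where
      ClosedAt : Pred Carrier (c ⊔ ℓ)
      ClosedAt y = X y → X (a ∙ y)
      ¬¬closed-at : ∀ y → DoubleNegation (ClosedAt y)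
      ¬¬closed-at y not-closed =
        not-closed (λ y∈X → ⊥-elim (no-escape (y , y∈X , λ ay∈X → not-closed (λ _ → ay∈X))))
      ClosedAt-resp : ClosedAt Respects _≈_
      ClosedAt-resp y≈y′ closed-y y′∈X = X-resp (∙-congˡ y≈y′) (closed-y (X-resp (sym y≈y′) y′∈X))
      closed⇒Stab : All ClosedAt L → Stab G X a
      closed⇒Stab closed-on-L =
        let (d , a-torsion) = finite-closed⇒torsion x₀∈X X⊆L closed
        in torsion-closed⇒Stab {d = d} a-torsion closed
        where
        closed : ∀ {x} → X x → X (a ∙ x)
        closed x∈X = All.lookupₛ setoid ClosedAt-resp closed-on-L (X⊆L x∈X) x∈X

  infixl 6 _+Σ_

  _+Σ_ : SubsetOf G → List Carrier → SubsetOf G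
  X +Σ []      = X
  X +Σ (a ∷ T) = (X +Σ T) ∪ (a ∙ₛ (X +Σ T))

  +Σ-resp : ∀ {X} T → X Respects _≈_ → (X +Σ T) Respects _≈_
  +Σ-resp []      X-resp = X-resp
  +Σ-resp (a ∷ T) X-resp z≈z′ (inj₁ z∈) = inj₁ (+Σ-resp T X-resp z≈z′ z∈)
  +Σ-resp (a ∷ T) X-resp z≈z′ (inj₂ z∈) = inj₂ (∙ₛ-resp a _ z≈z′ z∈)

  ⊆+Σ : ∀ {X} T → X ⊆ X +Σ T
  ⊆+Σ []      x∈X = x∈X
  ⊆+Σ (a ∷ T) x∈X = inj₁ (⊆+Σ T x∈X)

  +Σ-translate : ∀ {X g} T → (∀ {x} → X x → X (g ∙ x)) → ∀ {z} → (X +Σ T) z → (X +Σ T) (g ∙ z)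
  +Σ-translate []      closed z∈ = closed z∈
  +Σ-translate (a ∷ T) closed (inj₁ z∈) = inj₁ (+Σ-translate T closed z∈)
  +Σ-translate {g = g} (a ∷ T) closed (inj₂ (y , y∈ , z≈ay)) =
    inj₂ (g ∙ y , +Σ-translate T closed y∈ , trans (∙-congˡ z≈ay) (x∙yz≈y∙xz g a y))

  +Σ-sound : ∀ {X} T {z} → (X +Σ T) z → ∃ λ x → X x × ∃ λ T′ → T′ ⊑ T × z ≈ x ∙ sumG G T′
  +Σ-sound []      {z} z∈X = z , z∈X , [] , [] , sym (identityʳ z)
  +Σ-sound (a ∷ T) (inj₁ z∈) =
    let (x , x∈X , T′ , T′⊑T , z≈) = +Σ-sound T z∈ in x , x∈X , T′ , a ∷ʳ T′⊑T , z≈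
  +Σ-sound (a ∷ T) (inj₂ (y , y∈ , z≈ay)) =
    let (x , x∈X , T′ , T′⊑T , y≈) = +Σ-sound T y∈
    in x , x∈X , a ∷ T′ , ≡.refl ∷ T′⊑T , trans z≈ay (trans (∙-congˡ y≈) (x∙yz≈y∙xz a x _))

  sumG∈+Σ : ∀ {X} T {T′} → X ε → T′ ⊑ T → (X +Σ T) (sumG G T′)
  sumG∈+Σ []      ε∈X []              = ε∈X
  sumG∈+Σ (a ∷ T) ε∈X (_ ∷ʳ T′⊑T)     = inj₁ (sumG∈+Σ T ε∈X T′⊑T)
  sumG∈+Σ (a ∷ T) ε∈X (≡.refl ∷ T′⊑T) = inj₂ (_ , sumG∈+Σ T ε∈X T′⊑T , refl)

  SubsetSums-resp : ∀ A → SubsetSums G A Respects _≈_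
  SubsetSums-resp A z≈z′ (A′ , A′⊑A , sum≈z) = A′ , A′⊑A , trans sum≈z z≈z′

  Stab+Σ⇔SubsetSums : ∀ A z → (Stab G (SubsetSums G A) +Σ A) z ⇔ SubsetSums G A z
  Stab+Σ⇔SubsetSums A z = mk⇔
    (λ z∈ → let (g , g∈stab , A′ , A′⊑A , z≈) = +Σ-sound A z∈
            in SubsetSums-resp A (sym z≈) (Stab⇒closed g∈stab (A′ , A′⊑A , refl)))
    (λ (A′ , A′⊑A , sum≈z) → +Σ-resp A Stab-resp sum≈z (sumG∈+Σ A ε∈Stab A′⊑A))
    where
    ε∈Stab : Stab G (SubsetSums G A) ε
    ε∈Stab = IsSubgroup.ε-closed (Stab-isSubgroup (SubsetSums-resp A))

  module _ {H : SubsetOf G} (H-subgroup : IsSubgroup H)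
           {LH : List Carrier} (LH-unique : Unique LH) (H⇔LH : ∀ y → H y ⇔ y ∈ LH) where
    open IsSubgroup H-subgroup

    -- A list witness for |H +Σ T| ≥ |H| + |H| · |T ∖ H|, with T ∖ H over-approximated by
    -- outside since membership in H is undecidable.
    record SumsetBound (T : List Carrier) : Set (c ⊔ ℓ) where
      field
        elements        : List Carrier
        outside         : List Carrier
        elements-unique : Unique elements
        elements⊆       : ∀ {z} → z ∈ elements → (H +Σ T) z
        length-elements : length elements ≡ length LH + length LH * length outside
        outside-covers  : ∀ {x} → x ∈ T → ¬ H x → x ∈ outside

    sumsetBound-[] : SumsetBound []
    sumsetBound-[] = record
      { elements        = LH
      ; outside         = []
      ; elements-unique = LH-unique
      ; elements⊆       = λ {z} → from (H⇔LH z)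
      ; length-elements = ≡.sym (≡.trans (≡.cong (length LH +_) (*-zeroʳ (length LH))) (+-identityʳ _))
      ; outside-covers  = λ ()
      }

    sumsetBound-∷-∈H : ∀ {a T} → H a → SumsetBound T → SumsetBound (a ∷ T)
    sumsetBound-∷-∈H a∈H bound = record
      { elements        = elements
      ; outside         = outside
      ; elements-unique = elements-unique
      ; elements⊆       = λ z∈ → inj₁ (elements⊆ z∈)
      ; length-elements = length-elements
      ; outside-covers  = λ
          { (here x≈a)  x∉H → ⊥-elim (x∉H (resp (sym x≈a) a∈H))
          ; (there x∈T) x∉H → outside-covers x∈T x∉H
          }
      }
      where open SumsetBound bound

    -- H +Σ T is a union of H-cosets missing a ∙ y, so it is disjoint from the coset of a ∙ y.
    sumsetBound-∷-coset : ∀ {a T y} → (H +Σ T) y → ¬ (H +Σ T) (a ∙ y) →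
                          SumsetBound T → SumsetBound (a ∷ T)
    sumsetBound-∷-coset {a} {T} {y} y∈ ay∉ bound = record
      { elements        = elements ++ coset
      ; outside         = a ∷ outside
      ; elements-unique = SetoidUniqueProperties.++⁺ setoid elements-unique coset-unique disjoint
      ; elements⊆       = new-elements⊆
      ; length-elements = new-length
      ; outside-covers  = λ
          { (here x≈a)  _   → here x≈a
          ; (there x∈T) x∉H → there (outside-covers x∈T x∉H)
          }
      }
      where
      open SumsetBound bound
      coset : List Carrier
      coset = map (_∙ (a ∙ y)) LH
      coset-unique : Unique coset
      coset-unique =
        SetoidUniqueProperties.map⁺ setoid setoid (λ {g} {g′} → ∙-cancelʳ (a ∙ y) g g′) LH-unique
      coset⁻ : ∀ {z} → z ∈ coset → ∃ λ g → H g × z ≈ g ∙ (a ∙ y)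
      coset⁻ {z} z∈coset =
        let (g , g∈LH , z≈) = SetoidMembershipProperties.∈-map⁻ setoid setoid z∈coset
        in g , from (H⇔LH g) g∈LH , z≈
      disjoint : ∀ {z} → ¬ (z ∈ elements × z ∈ coset)
      disjoint (z∈elements , z∈coset) =
        let (g , g∈H , z≈) = coset⁻ z∈coset
        in ay∉ (+Σ-resp T resp (trans (∙-congˡ z≈) (\\-leftDividesʳ g (a ∙ y)))
                 (+Σ-translate T (∙-closed (⁻¹-closed g∈H)) (elements⊆ z∈elements)))
      new-elements⊆ : ∀ {z} → z ∈ elements ++ coset → (H +Σ (a ∷ T)) z
      new-elements⊆ z∈ with ++⁻ elements z∈
      ... | inj₁ z∈elements = inj₁ (elements⊆ z∈elements)
      ... | inj₂ z∈coset    =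
        let (g , g∈H , z≈) = coset⁻ z∈coset
        in inj₂ (g ∙ y , +Σ-translate T (∙-closed g∈H) y∈ , trans z≈ (x∙yz≈y∙xz g a y))
      new-length : length (elements ++ coset) ≡ length LH + length LH * length (a ∷ outside)
      new-length = let h = length LH in begin
        length (elements ++ coset)          ≡⟨ length-++ elements ⟩
        length elements + length coset      ≡⟨ ≡.cong₂ _+_ length-elements (length-map _ LH) ⟩
        (h + h * length outside) + h        ≡⟨ +-comm _ h ⟩
        h + (h + h * length outside)        ≡⟨ ≡.cong (h +_) (*-suc h (length outside)) ⟨
        h + h * suc (length outside)        ∎
        where open ≡.≡-Reasoning

    ¬¬sumsetBound : ∀ T {L} → (H +Σ T) ⊆ (_∈ L) → Stab G (H +Σ T) ⊆ H →
                    DoubleNegation (SumsetBound T)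
    ¬¬sumsetBound []      _    _        = pure sumsetBound-[]
    ¬¬sumsetBound (a ∷ T) {L} ⊆L stab⊆H = do
      bound ← ¬¬sumsetBound T T⊆L T-stab⊆H
      no a∉H ← ¬¬-excluded-middle
        where yes a∈H → pure (sumsetBound-∷-∈H a∈H bound)
      (y , y∈ , ay∉) ← ¬Stab⇒¬¬escape (+Σ-resp T resp) (⊆+Σ T ε-closed) T⊆L
                         (λ a∈stab → a∉H (T-stab⊆H a∈stab))
      pure (sumsetBound-∷-coset y∈ ay∉ bound)
      where
      T⊆L : (H +Σ T) ⊆ (_∈ L)
      T⊆L z∈ = ⊆L (inj₁ z∈)
      T-stab⊆H : Stab G (H +Σ T) ⊆ H
      T-stab⊆H g∈stab = stab⊆H (Stab-⊆-extend a g∈stab)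

    +Σ-size-lowerBound : ∀ T {L K} → (H +Σ T) ⊆ (_∈ L) → Stab G (H +Σ T) ⊆ H →
                         Unique K → (∀ {x} → x ∈ K → x ∈ T × ¬ H x) →
                         length LH + length LH * length K ≤ length L
    +Σ-size-lowerBound T {L} {K} ⊆L stab⊆H K-unique K⊆T∖H =
      decidable-stable (_ ≤? _) (¬¬-map size-bound (¬¬sumsetBound T ⊆L stab⊆H))
      where
      size-bound : SumsetBound T → length LH + length LH * length K ≤ length L
      size-bound bound = let h = length LH in begin
        h + h * length K        ≤⟨ +-monoʳ-≤ h (*-monoʳ-≤ h K≤outside) ⟩
        h + h * length outside  ≡⟨ length-elements ⟨
        length elements         ≤⟨ unique-⊆⇒length≤ setoid elements-unique elements⊆L ⟩
        length L                ∎
        where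
        open SumsetBound bound
        open ≤-Reasoning
        K≤outside : length K ≤ length outside
        K≤outside = unique-⊆⇒length≤ setoid K-unique
          (λ x∈K → let (x∈T , x∉H) = K⊆T∖H x∈K in outside-covers x∈T x∉H)
        elements⊆L : ∀ {z} → z ∈ elements → z ∈ L
        elements⊆L z∈ = ⊆L (elements⊆ z∈)

corollary4 : {c ℓ : Level} (G : AbelianGroup c ℓ) (A : List (AbelianGroup.Carrier G)) →
    IsFiniteSet G A →
    (s h k : ℕ) →
    HasSize G (SubsetSums G A) s →
    HasSize G (Stab G (SubsetSums G A)) h →
    HasSize G (Diff G A (Stab G (SubsetSums G A))) k →
    h + h * k ≤ s
corollary4 G A _ _ _ _ (LS , _ , ≡.refl , S⇔LS) (LH , LH-unique , ≡.refl , H⇔LH)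
                       (LD , LD-unique , ≡.refl , D⇔LD) =
  +Σ-size-lowerBound G (Stab-isSubgroup G (SubsetSums-resp G A)) LH-unique H⇔LH A
    (λ {z} z∈ → to (S⇔LS z) (to (Stab+Σ⇔SubsetSums G A z) z∈))
    (Stab-cong G (Stab+Σ⇔SubsetSums G A))
    LD-unique (λ {x} x∈LD → from (D⇔LD x) x∈LD)
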